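{- Let $q_{n,d}$ be the number of $d$-dimensional cubes in the state complex of the robot $QR_n$. Then \[\sum_{n,d\ge0} q_{n,d}\,x^ny^d=\frac{1+xy}{1-2x-x^2y}.\]
   Context: The robotic arm $QR_n$: $n$ unit links with base at $(0,0)$ of the $n\times n$ grid, each facing north or east; states are the NE lattice paths of length $n$. Moves: corner switch at $i$ ($1\le i\le n-1$), interchanging links $i,i+1$ if they are N,E or E,N (involves links $\{i,i+1\}$); end flip, switching link $n$ between E and N (involves link $\{n\}$). The state complex $\mathcal{S}(QR_n)$ has the states as vertices and, for each state $u$ and each set of $k$ moves applicable at $u$ with pairwise disjoint involved links, a $k$-cube whose vertices are the $2^k$ states obtained by applying subsets of these moves to $u$. For $n=0$ the convention is that there is a single state and no moves, so $q_{0,0}=1$ and $q_{0,d}=0$ for $d>0$. -}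

module Defs where

open import Data.Bool using (Bool; true; false; not; _∧_; _∨_; if_then_else_)
open import Data.Bool.Properties using (T?)
open import Data.Nat using (ℕ; zero; suc; _∸_; _≡ᵇ_)
open import Data.Integer using (ℤ; +_; -[1+_]) renaming (_+_ to _+ℤ_; _*_ to _*ℤ_)
open import Data.List using (List; []; _∷_; _++_; map; length; filter; upTo; concatMap; deduplicateᵇ)
open import Data.Bool.ListAction using (all; any)
open import Data.Product using (_×_; _,_)

-- The robotic arm QR_n.
-- A state is a list of n links; true = N (north), false = E (east).
-- Links are indexed 0,…,n-1 (paper: 1,…,n).

State : Set
State = List Bool

allStates : ℕ → List State
allStates zero    = [] ∷ []
allStates (suc n) = map (true ∷_) (allStates n) ++ map (false ∷_) (allStates n)

-- Moves: corner switch at links i,i+1 (0-based i, 0 ≤ i ≤ n-2), end flip of link n-1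
data Move : Set where
  corner  : ℕ → Move
  endflip : Move

moves : ℕ → List Move
moves zero    = []
moves (suc n) = map corner (upTo n) ++ (endflip ∷ [])

involved : ℕ → Move → List ℕ
involved n (corner i) = i ∷ suc i ∷ []
involved n endflip    = (n ∸ 1) ∷ []

get : ℕ → State → Bool → Bool   -- with default value (never used for valid indices)
get _       []       d = d
get zero    (b ∷ bs) d = b
get (suc i) (b ∷ bs) d = get i bs d

cornerOK : ℕ → State → Bool
cornerOK zero    (a ∷ b ∷ _) = not (a ∧ b) ∧ (a ∨ b)
cornerOK zero    _           = false
cornerOK (suc i) []          = false
cornerOK (suc i) (_ ∷ bs)    = cornerOK i bs

applicable : ℕ → Move → State → Bool
applicable n (corner i) u = cornerOK i u
applicable n endflip    u = not (n ≡ᵇ 0)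

swapAt : ℕ → State → State
swapAt zero    (a ∷ b ∷ bs) = b ∷ a ∷ bs
swapAt zero    bs           = bs
swapAt (suc i) []           = []
swapAt (suc i) (b ∷ bs)     = b ∷ swapAt i bs

flipAt : ℕ → State → State
flipAt _       []       = []
flipAt zero    (b ∷ bs) = not b ∷ bs
flipAt (suc i) (b ∷ bs) = b ∷ flipAt i bs

applyMove : ℕ → Move → State → State
applyMove n (corner i) u = swapAt i u
applyMove n endflip    u = flipAt (n ∸ 1) u

applyMoves : ℕ → List Move → State → State
applyMoves n []       u = u
applyMoves n (m ∷ ms) u = applyMoves n ms (applyMove n m u)

subsets : {A : Set} → List A → List (List A)
subsets []       = [] ∷ []
subsets (x ∷ xs) = map (x ∷_) (subsets xs) ++ subsets xs

_∈ᵇ_ : ℕ → List ℕ → Bool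
k ∈ᵇ ks = any (λ j → k ≡ᵇ j) ks

disjointᵇ : List ℕ → List ℕ → Bool
disjointᵇ as bs = all (λ a → not (a ∈ᵇ bs)) as

pairwiseDisjoint : ℕ → List Move → Bool
pairwiseDisjoint n []       = true
pairwiseDisjoint n (m ∷ ms) =
  all (λ m' → disjointᵇ (involved n m) (involved n m')) ms ∧ pairwiseDisjoint n ms

eqState : State → State → Bool
eqState []       []       = true
eqState (a ∷ as) (b ∷ bs) = (if a then b else not b) ∧ eqState as bs
eqState _        _        = false

-- a cube is given by (u, S): u a state, S a set of k moves applicable at u with
-- pairwise disjoint involved links
IsCubeData : ℕ → ℕ → State × List Move → Bool
IsCubeData n k (u , S) = (length S ≡ᵇ k) ∧ all (λ m → applicable n m u) S ∧ pairwiseDisjoint n S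

-- vertex set of the cube (u,S): all states obtained by applying subsets of S to u,
-- encoded as its characteristic vector over allStates n
vertexSet : ℕ → State × List Move → List Bool
vertexSet n (u , S) =
  map (λ v → any (λ T → eqState v (applyMoves n T u)) (subsets S)) (allStates n)

eqBools : List Bool → List Bool → Bool
eqBools = eqState

-- q n d = number of distinct d-dimensional cubes (as vertex sets) of S(QR_n)
q : ℕ → ℕ → ℕ
q n d = length (deduplicateᵇ eqBools
          (map (vertexSet n)
            (filter (λ c → T? (IsCubeData n d c))
              (concatMap (λ u → map (u ,_) (subsets (moves n))) (allStates n)))))

-- Formal power series in x,y over ℤ: coefficient of x^n y^d

PS : Set
PS = ℕ → ℕ → ℤ

sumTo : ℕ → (ℕ → ℤ) → ℤ
sumTo zero    f = f zero
sumTo (suc n) f = sumTo n f +ℤ f (suc n)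

_⋆_ : PS → PS → PS
(f ⋆ g) n d = sumTo n (λ i → sumTo d (λ j → f i j *ℤ g (n ∸ i) (d ∸ j)))

Qseries : PS
Qseries n d = + q n d

numer : PS
numer 0 0 = + 1
numer 1 1 = + 1
numer _ _ = + 0

denom : PS
denom 0 0 = + 1
denom 1 0 = -[1+ 1 ]
denom 2 1 = -[1+ 0 ]
denom _ _ = + 0

-- A cube of S(QR_n) is determined by its vertex set, and the possible vertex sets are
-- described by words over N, E, C, F read from the base of the arm: N or E for a link
-- fixed north or east, C for two links exchanged by a corner switch, and F for the end
-- flip, which can only be the last letter. Distinct words give distinct vertex sets, so
-- q_{n,d} counts the words of width n (C occupies two links) with d letters C or F.
-- Splitting off the first letter gives q_{n,d} = 2 q_{n-1,d} + q_{n-2,d-1} for n ≥ 2,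
-- with q_{0,0} = 1, q_{1,0} = 2 and q_{1,1} = 1, which is the coefficientwise form of
-- Q(x,y) (1 - 2x - x²y) = 1 + xy.

module Submission where

open import Defs
open import Data.Bool using (Bool; true; false; not; _∧_; _∨_; if_then_else_; T)
import Data.Bool as Bool
open import Data.Bool.ListAction using (all; any; and; or)
open import Data.Bool.Properties using (T?; T-∧; T-∨; ∨-comm; ∨-assoc; ∨-identityʳ)
open import Data.Empty using (⊥-elim)
open import Data.Integer using (ℤ; +_; -[1+_]; _-_) renaming (_+_ to _+ℤ_; _*_ to _*ℤ_)
open import Data.Integer.Properties using (*-zeroʳ; *-identityʳ; +-identityˡ; +-identityʳ)
open import Data.Integer.Tactic.RingSolver using (solve-∀)
open import Data.List using (List; []; _∷_; _++_; map; length; filter; concatMap; upTo; applyUpTo; cartesianProduct; deduplicate; deduplicateᵇ)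
open import Data.List.Membership.Propositional using (_∈_; find; lose)
open import Data.List.Membership.Propositional.Properties using (∈-map⁺; ∈-map⁻; ∈-++⁺ˡ; ∈-++⁺ʳ; ∈-++⁻; ∈-concatMap⁺; ∈-concatMap⁻; ∈-cartesianProduct⁺; ∈-cartesianProduct⁻; ∈-map∘filter⁺; ∈-map∘filter⁻; deduplicate-∈⇔)
open import Data.List.Membership.Propositional.Properties.WithK using (unique∧set⇒bag)
open import Data.List.Properties using (map-++; map-∘; map-cong; length-++; length-map; map-applyUpTo; ∷-injectiveˡ; ∷-injectiveʳ; ≡-dec; filter-≐)
open import Data.List.Relation.Binary.BagAndSetEquality using (∼bag⇒↭)
open import Data.List.Relation.Binary.Disjoint.Propositional using (Disjoint)
open import Data.List.Relation.Binary.Permutation.Propositional.Properties using (↭-length)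
open import Data.List.Relation.Unary.All as All using ([]; _∷_)
open import Data.List.Relation.Unary.All.Properties using () renaming (map⁺ to All-map⁺)
open import Data.List.Relation.Unary.AllPairs using ([]; _∷_)
open import Data.List.Relation.Unary.Any using (here; there)
open import Data.List.Relation.Unary.Unique.DecPropositional.Properties using (deduplicate-!)
open import Data.List.Relation.Unary.Unique.Propositional using (Unique)
import Data.List.Relation.Unary.Unique.Propositional.Properties as Unique
open import Data.Nat using (ℕ; zero; suc; _+_; _∸_; _≤_; _<_; z≤n; s≤s; _≟_)
open import Data.Nat.ListAction using (sum)
open import Data.Nat.Properties using (≤-refl; m≤n⇒m≤1+n; n∸n≡0; m+n∸n≡m; +-∸-assoc; ≡ᵇ⇒≡; ≡⇒≡ᵇ)
import Data.Product as Product
open import Data.Product using (_×_; _,_; proj₂; ∃; ∃₂; ∃-syntax)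
open import Data.Sum using (_⊎_; inj₁; inj₂; [_,_]′)
open import Function using (_∘_; _⇔_; mk⇔; Equivalence)
open import Relation.Binary.Definitions using (DecidableEquality)
open import Relation.Binary.PropositionalEquality using (_≡_; _≢_; refl; sym; trans; cong; cong₂; subst; _≗_; module ≡-Reasoning)
open import Relation.Nullary using (¬_; ¬?; Dec; yes; no)
open import Relation.Unary using (_≐_)

open Equivalence using (to; from)
open ≡-Reasoning

module _ {A : Set} where

  any-++ : ∀ (p : A → Bool) xs ys → any p (xs ++ ys) ≡ any p xs ∨ any p ys
  any-++ p []       ys = refl
  any-++ p (x ∷ xs) ys = trans (cong (p x ∨_) (any-++ p xs ys)) (sym (∨-assoc (p x) _ _))

  any-map : ∀ {B : Set} (p : B → Bool) (f : A → B) xs → any p (map f xs) ≡ any (p ∘ f) xs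
  any-map p f xs = cong or (sym (map-∘ xs))

  any-cong : ∀ {p q : A → Bool} → p ≗ q → ∀ xs → any p xs ≡ any q xs
  any-cong p≗q xs = cong or (map-cong p≗q xs)

  any-false : ∀ (xs : List A) → any (λ _ → false) xs ≡ false
  any-false []       = refl
  any-false (x ∷ xs) = any-false xs

  any-∧ˡ : ∀ b (p : A → Bool) xs → any (λ x → b ∧ p x) xs ≡ b ∧ any p xs
  any-∧ˡ true  p xs = refl
  any-∧ˡ false p xs = any-false xs

  all-map : ∀ {B : Set} (p : B → Bool) (f : A → B) xs → all p (map f xs) ≡ all (p ∘ f) xs
  all-map p f xs = cong and (sym (map-∘ xs))

  all-cong : ∀ {p q : A → Bool} → p ≗ q → ∀ xs → all p xs ≡ all q xs
  all-cong p≗q xs = cong and (map-cong p≗q xs)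

  subsets-map : ∀ {B : Set} (f : A → B) xs → subsets (map f xs) ≡ map (map f) (subsets xs)
  subsets-map f []       = refl
  subsets-map f (x ∷ xs) = begin
    map (f x ∷_) (subsets (map f xs)) ++ subsets (map f xs)
      ≡⟨ cong (λ yss → map (f x ∷_) yss ++ yss) (subsets-map f xs) ⟩
    map (f x ∷_) (map (map f) (subsets xs)) ++ map (map f) (subsets xs)
      ≡⟨ cong (_++ _) (trans (sym (map-∘ {g = f x ∷_} {f = map f} (subsets xs))) (map-∘ (subsets xs))) ⟩
    map (map f) (map (x ∷_) (subsets xs)) ++ map (map f) (subsets xs)
      ≡⟨ map-++ (map f) (map (x ∷_) (subsets xs)) (subsets xs) ⟨
    map (map f) (map (x ∷_) (subsets xs) ++ subsets xs) ∎

  ∈-subsets-∷⁻ : ∀ (x : A) xs {S} → S ∈ subsets (x ∷ xs) →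
    (∃[ S′ ] S ≡ x ∷ S′ × S′ ∈ subsets xs) ⊎ S ∈ subsets xs
  ∈-subsets-∷⁻ x xs p with ∈-++⁻ (map (x ∷_) (subsets xs)) p
  ... | inj₁ q with ∈-map⁻ (x ∷_) q
  ...   | S′ , q′ , eq = inj₁ (S′ , eq , q′)
  ∈-subsets-∷⁻ x xs p | inj₂ q = inj₂ q

  ∈-subsets-map⁻ : ∀ {B : Set} (f : A → B) xs {S} → S ∈ subsets (map f xs) →
    ∃[ S′ ] S ≡ map f S′ × S′ ∈ subsets xs
  ∈-subsets-map⁻ f xs p with ∈-map⁻ (map f) (subst (_ ∈_) (subsets-map f xs) p)
  ... | S′ , q , eq = S′ , eq , q

  ∈-subsets-map⁺ : ∀ {B : Set} (f : A → B) xs {S} → S ∈ subsets xs → map f S ∈ subsets (map f xs)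
  ∈-subsets-map⁺ f xs p = subst (_ ∈_) (sym (subsets-map f xs)) (∈-map⁺ (map f) p)

  unique-prefixed : ∀ (f : A → List (List A)) {ls} → Unique ls → (∀ l → Unique (f l)) →
    Unique (concatMap (λ l → map (l ∷_) (f l)) ls)
  unique-prefixed f []              f! = []
  unique-prefixed f {l ∷ ls} (l∉ls ∷ ls!) f! =
    Unique.++⁺ (Unique.map⁺ ∷-injectiveʳ (f! l)) (unique-prefixed f ls! f!) disjoint
    where
    disjoint : Disjoint (map (l ∷_) (f l)) (concatMap (λ l → map (l ∷_) (f l)) ls)
    disjoint (v∈ , v∈′) with ∈-map⁻ (l ∷_) v∈ | find (∈-concatMap⁻ (λ l → map (l ∷_) (f l)) {xs = ls} v∈′)
    ... | _ , _ , refl | l′ , l′∈ls , v∈″ with ∈-map⁻ (l′ ∷_) v∈″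
    ...   | _ , _ , eq = All.lookup l∉ls l′∈ls (∷-injectiveˡ eq)

  length-prefixed : ∀ (f : A → List (List A)) ls →
    length (concatMap (λ l → map (l ∷_) (f l)) ls) ≡ sum (map (length ∘ f) ls)
  length-prefixed f []       = refl
  length-prefixed f (l ∷ ls) =
    trans (length-++ (map (l ∷_) (f l))) (cong₂ _+_ (length-map (l ∷_) (f l)) (length-prefixed f ls))

module _ {A B : Set} where

  map-≡⇒agree : ∀ {f g : A → B} xs → map f xs ≡ map g xs → ∀ {x} → x ∈ xs → f x ≡ g x
  map-≡⇒agree (x ∷ xs) eq (here refl) = ∷-injectiveˡ eq
  map-≡⇒agree (x ∷ xs) eq (there p)   = map-≡⇒agree xs (∷-injectiveʳ eq) p

  unique-map-injectiveOn : ∀ {f : A → B} {xs} →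
    (∀ {x y} → x ∈ xs → y ∈ xs → f x ≡ f y → x ≡ y) → Unique xs → Unique (map f xs)
  unique-map-injectiveOn f-inj []          = []
  unique-map-injectiveOn f-inj (x∉ ∷ xs!) =
    All-map⁺ (All.tabulate (λ y∈ fx≡fy → All.lookup x∉ y∈ (f-inj (here refl) (there y∈) fx≡fy)))
    ∷ unique-map-injectiveOn (λ x∈ y∈ → f-inj (there x∈) (there y∈)) xs!

length-deduplicate : ∀ {A : Set} (_≟_ : DecidableEquality A) {xs ys : List A} →
  (∀ {z} → z ∈ xs ⇔ z ∈ ys) → Unique ys → length (deduplicate _≟_ xs) ≡ length ys
length-deduplicate _≟_ {xs} xs⇔ys ys! =
  ↭-length (∼bag⇒↭ (unique∧set⇒bag (deduplicate-! _≟_ xs) ys!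
    (mk⇔ (to xs⇔ys ∘ from (deduplicate-∈⇔ _≟_)) (to (deduplicate-∈⇔ _≟_) ∘ from xs⇔ys))))

concatMap-pairs : ∀ {A B : Set} (xs : List A) (ys : List B) →
  concatMap (λ x → map (x ,_) ys) xs ≡ cartesianProduct xs ys
concatMap-pairs []       ys = refl
concatMap-pairs (x ∷ xs) ys = cong (map (x ,_) ys ++_) (concatMap-pairs xs ys)

-- Cube types

data Letter : Set where
  N E C F : Letter

Word : Set
Word = List Letter

letter : Bool → Letter
letter true  = N
letter false = E

infixr 5 _◃_

_◃_ : Bool → (State → Bool) → State → Bool
(a ◃ p) []      = false
(a ◃ p) (b ∷ v) = (if b then a else not a) ∧ p v

matches : Word → State → Bool
matches []      v = eqState v []
matches (N ∷ w) v = (true ◃ matches w) v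
matches (E ∷ w) v = (false ◃ matches w) v
matches (C ∷ w) v = (true ◃ false ◃ matches w) v ∨ (false ◃ true ◃ matches w) v
matches (F ∷ w) v = (true ◃ matches w) v ∨ (false ◃ matches w) v

◃-cong : ∀ a {p q : State → Bool} → p ≗ q → a ◃ p ≗ a ◃ q
◃-cong a p≗q []      = refl
◃-cong a p≗q (b ∷ v) = cong (_ ∧_) (p≗q v)

matches-letter : ∀ a w → matches (letter a ∷ w) ≗ a ◃ matches w
matches-letter true  w v = refl
matches-letter false w v = refl

matches-C : ∀ a w v →
  (not a ◃ a ◃ matches w) v ∨ (a ◃ not a ◃ matches w) v ≡ matches (C ∷ w) v
matches-C true  w v = ∨-comm ((false ◃ true ◃ matches w) v) _
matches-C false w v = refl

matches-F : ∀ a w v → (not a ◃ matches w) v ∨ (a ◃ matches w) v ≡ matches (F ∷ w) v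
matches-F true  w v = ∨-comm ((false ◃ matches w) v) _
matches-F false w v = refl

any-◃ : ∀ {A : Set} a (f : A → State) xs →
  (λ v → any (λ x → eqState v (a ∷ f x)) xs) ≗ a ◃ (λ v → any (λ x → eqState v (f x)) xs)
any-◃ a f xs []      = any-false xs
any-◃ a f xs (b ∷ v) = any-∧ˡ _ (λ x → eqState v (f x)) xs

spans : ℕ → State → List Move → State → Bool
spans n u S v = any (λ T → eqState v (applyMoves n T u)) (subsets S)

shiftMove : Move → Move
shiftMove (corner i) = corner (suc i)
shiftMove endflip    = endflip

spans-∷ : ∀ n u m S v → spans n u (m ∷ S) v ≡ spans n (applyMove n m u) S v ∨ spans n u S v
spans-∷ n u m S v =
  trans (any-++ _ (map (m ∷_) (subsets S)) (subsets S))
        (cong (_∨ spans n u S v) (any-map _ (m ∷_) (subsets S)))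

applyMoves-shift : ∀ n T a u →
  applyMoves (suc (suc n)) (map shiftMove T) (a ∷ u) ≡ a ∷ applyMoves (suc n) T u
applyMoves-shift n []             a u = refl
applyMoves-shift n (corner i ∷ T) a u = applyMoves-shift n T a (swapAt i u)
applyMoves-shift n (endflip ∷ T)  a u = applyMoves-shift n T a (flipAt n u)

spans-shift : ∀ n a u S → spans (suc (suc n)) (a ∷ u) (map shiftMove S) ≗ a ◃ spans (suc n) u S
spans-shift n a u S v = begin
  any (λ T → eqState v (applyMoves (suc (suc n)) T (a ∷ u))) (subsets (map shiftMove S))
    ≡⟨ cong (any _) (subsets-map shiftMove S) ⟩
  any _ (map (map shiftMove) (subsets S))
    ≡⟨ any-map _ (map shiftMove) (subsets S) ⟩
  any (λ T → eqState v (applyMoves (suc (suc n)) (map shiftMove T) (a ∷ u))) (subsets S)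
    ≡⟨ any-cong (λ T → cong (eqState v) (applyMoves-shift n T a u)) (subsets S) ⟩
  any (λ T → eqState v (a ∷ applyMoves (suc n) T u)) (subsets S)
    ≡⟨ any-◃ a (λ T → applyMoves (suc n) T u) (subsets S) v ⟩
  (a ◃ spans (suc n) u S) v ∎

-- Removing the first link (the first two, for a corner) leaves a cube of the shorter arm,
-- whose moves are renumbered by shiftMove.
data HasType : ℕ → State → List Move → Word → Set where
  []     : HasType 0 [] [] []
  fixed  : ∀ {n u S w} a → HasType n u S w →
           HasType (suc n) (a ∷ u) (map shiftMove S) (letter a ∷ w)
  switch : ∀ {n u S w} a → HasType n u S w →
           HasType (suc (suc n)) (a ∷ not a ∷ u)
                   (corner 0 ∷ map shiftMove (map shiftMove S)) (C ∷ w)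
  flip   : ∀ a → HasType 1 (a ∷ []) (endflip ∷ []) (F ∷ [])

-- The typing is only used to exclude the end flip of the empty arm.
spans-cons : ∀ {n u S w} → HasType n u S w →
  ∀ a → spans (suc n) (a ∷ u) (map shiftMove S) ≗ a ◃ spans n u S
spans-cons {zero}          []  a = any-◃ a (λ T → applyMoves 0 T []) ([] ∷ [])
spans-cons {suc n} {u} {S} _   a = spans-shift n a u S

spans-matches : ∀ {n u S w} → HasType n u S w → spans n u S ≗ matches w
spans-matches [] v = ∨-identityʳ (eqState v [])
spans-matches (fixed {n} {u} {S} {w} a r) v = begin
  spans (suc n) (a ∷ u) (map shiftMove S) v ≡⟨ spans-cons r a v ⟩
  (a ◃ spans n u S) v                       ≡⟨ ◃-cong a (spans-matches r) v ⟩
  (a ◃ matches w) v                         ≡⟨ matches-letter a w v ⟨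
  matches (letter a ∷ w) v                  ∎
spans-matches {suc (suc n)} (switch {u = u} {S = S} {w = w} a r) v = begin
  spans _ (a ∷ not a ∷ u) (corner 0 ∷ M) v
    ≡⟨ spans-∷ _ (a ∷ not a ∷ u) (corner 0) M v ⟩
  spans _ (not a ∷ a ∷ u) M v ∨ spans _ (a ∷ not a ∷ u) M v
    ≡⟨ cong₂ _∨_ (peel (not a) a) (peel a (not a)) ⟩
  (not a ◃ a ◃ matches w) v ∨ (a ◃ not a ◃ matches w) v
    ≡⟨ matches-C a w v ⟩
  matches (C ∷ w) v ∎
  where
  M = map shiftMove (map shiftMove S)
  peel : ∀ x y → spans (suc (suc n)) (x ∷ y ∷ u) M v ≡ (x ◃ y ◃ matches w) v
  peel x y = trans (spans-cons (fixed y r) x v)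
                   (◃-cong x (λ v′ → trans (spans-cons r y v′) (◃-cong y (spans-matches r) v′)) v)
spans-matches (flip a) v = begin
  spans 1 (a ∷ []) (endflip ∷ []) v                  ≡⟨ spans-∷ 1 (a ∷ []) endflip [] v ⟩
  spans 1 (not a ∷ []) [] v ∨ spans 1 (a ∷ []) [] v  ≡⟨ cong₂ _∨_ (peel (not a)) (peel a) ⟩
  (not a ◃ matches []) v ∨ (a ◃ matches []) v        ≡⟨ matches-F a [] v ⟩
  matches (F ∷ []) v                                 ∎
  where
  peel : ∀ x → spans 1 (x ∷ []) [] v ≡ (x ◃ matches []) v
  peel x = trans (spans-cons [] x v) (◃-cong x (spans-matches []) v)

-- Valid sets of moves

moves-suc : ∀ n → moves (suc (suc n)) ≡ corner 0 ∷ map shiftMove (moves (suc n))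
moves-suc n = cong (corner 0 ∷_) (begin
  map corner (applyUpTo suc n) ++ endflip ∷ []
    ≡⟨ cong (_++ _) (map-applyUpTo suc corner n) ⟩
  applyUpTo (corner ∘ suc) n ++ endflip ∷ []
    ≡⟨ cong (_++ _) (map-applyUpTo (λ i → i) (shiftMove ∘ corner) n) ⟨
  map (shiftMove ∘ corner) (upTo n) ++ endflip ∷ []
    ≡⟨ cong (_++ _) (map-∘ (upTo n)) ⟩
  map shiftMove (map corner (upTo n)) ++ endflip ∷ []
    ≡⟨ map-++ shiftMove (map corner (upTo n)) (endflip ∷ []) ⟨
  map shiftMove (moves (suc n)) ∎)

data MovesView (n : ℕ) : List Move → Set where
  skip : ∀ {S} → S ∈ subsets (moves (suc n)) → MovesView n (map shiftMove S)
  keep : ∀ {S} → S ∈ subsets (moves (suc n)) → MovesView n (corner 0 ∷ map shiftMove S)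

movesView : ∀ n {S} → S ∈ subsets (moves (suc (suc n))) → MovesView n S
movesView n {S} p with ∈-subsets-∷⁻ (corner 0) (map shiftMove (moves (suc n))) (subst (λ ms → S ∈ subsets ms) (moves-suc n) p)
... | inj₁ (_ , refl , q) with ∈-subsets-map⁻ shiftMove (moves (suc n)) q
...   | _ , refl , q′ = keep q′
movesView n p | inj₂ q with ∈-subsets-map⁻ shiftMove (moves (suc n)) q
... | _ , refl , q′ = skip q′

∈-moves-skip : ∀ n {S} → S ∈ subsets (moves (suc n)) →
  map shiftMove S ∈ subsets (moves (suc (suc n)))
∈-moves-skip n {S} p = subst (λ ms → map shiftMove S ∈ subsets ms) (sym (moves-suc n))
  (∈-++⁺ʳ _ (∈-subsets-map⁺ shiftMove (moves (suc n)) p))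

∈-moves-keep : ∀ n {S} → S ∈ subsets (moves (suc n)) →
  corner 0 ∷ map shiftMove S ∈ subsets (moves (suc (suc n)))
∈-moves-keep n {S} p = subst (λ ms → corner 0 ∷ map shiftMove S ∈ subsets ms) (sym (moves-suc n))
  (∈-++⁺ˡ (∈-map⁺ (corner 0 ∷_) (∈-subsets-map⁺ shiftMove (moves (suc n)) p)))

∈-moves-shift : ∀ n {S} → S ∈ subsets (moves n) → map shiftMove S ∈ subsets (moves (suc n))
∈-moves-shift zero    (here refl) = there (here refl)
∈-moves-shift (suc n) p           = ∈-moves-skip n p

applicable-shift : ∀ n a u S →
  all (λ m → applicable (suc (suc n)) m (a ∷ u)) (map shiftMove S) ≡
  all (λ m → applicable (suc n) m u) S
applicable-shift n a u S = trans (all-map _ shiftMove S) (all-cong shifted S)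
  where
  shifted : ∀ m → applicable (suc (suc n)) (shiftMove m) (a ∷ u) ≡ applicable (suc n) m u
  shifted (corner i) = refl
  shifted endflip    = refl

pairwiseDisjoint-shift : ∀ n S →
  pairwiseDisjoint (suc (suc n)) (map shiftMove S) ≡ pairwiseDisjoint (suc n) S
pairwiseDisjoint-shift n []      = refl
pairwiseDisjoint-shift n (m ∷ S) =
  cong₂ _∧_ (trans (all-map _ shiftMove S) (all-cong (shifted m) S)) (pairwiseDisjoint-shift n S)
  where
  shifted : ∀ m m′ →
    disjointᵇ (involved (suc (suc n)) (shiftMove m)) (involved (suc (suc n)) (shiftMove m′)) ≡
    disjointᵇ (involved (suc n) m) (involved (suc n) m′)
  shifted (corner i) (corner j) = refl
  shifted (corner i) endflip    = refl
  shifted endflip    (corner j) = refl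
  shifted endflip    endflip    = refl

applicable-cons : ∀ {n u S w} → HasType n u S w → ∀ a →
  all (λ m → applicable (suc n) m (a ∷ u)) (map shiftMove S) ≡ all (λ m → applicable n m u) S
applicable-cons {zero}          [] a = refl
applicable-cons {suc n} {u} {S} _  a = applicable-shift n a u S

pairwiseDisjoint-cons : ∀ {n u S w} → HasType n u S w →
  pairwiseDisjoint (suc n) (map shiftMove S) ≡ pairwiseDisjoint n S
pairwiseDisjoint-cons {zero}      [] = refl
pairwiseDisjoint-cons {suc n} {S = S} _  = pairwiseDisjoint-shift n S

cornerOK-alternating : ∀ a u → T (cornerOK 0 (a ∷ not a ∷ u))
cornerOK-alternating true  u = _
cornerOK-alternating false u = _

cornerOK⇒alternating : ∀ a b u → T (cornerOK 0 (a ∷ b ∷ u)) → b ≡ not a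
cornerOK⇒alternating true  false u _ = refl
cornerOK⇒alternating false true  u _ = refl

clear-of-base-corner : ∀ {n u S w} → HasType n u S w →
  T (all (λ m → disjointᵇ (0 ∷ 1 ∷ []) (involved (suc (suc n)) m)) (map shiftMove (map shiftMove S)))
clear-of-base-corner {zero}      [] = _
clear-of-base-corner {suc n} {S = S} _ = clear S
  where
  clear : ∀ S → T (all (λ m → disjointᵇ (0 ∷ 1 ∷ []) (involved (suc (suc (suc n))) m))
                       (map shiftMove (map shiftMove S)))
  clear []             = _
  clear (corner i ∷ S) = clear S
  clear (endflip ∷ S)  = clear S

typed-length : ∀ {n u S w} → HasType n u S w → length u ≡ n
typed-length []           = refl
typed-length (fixed a r)  = cong suc (typed-length r)
typed-length (switch a r) = cong (suc ∘ suc) (typed-length r)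
typed-length (flip a)     = refl

typed-moves : ∀ {n u S w} → HasType n u S w → S ∈ subsets (moves n)
typed-moves []                   = here refl
typed-moves (fixed {n} a r)      = ∈-moves-shift n (typed-moves r)
typed-moves (switch {n} a r)     = ∈-moves-keep n (∈-moves-shift n (typed-moves r))
typed-moves (flip a)             = here refl

typed-applicable : ∀ {n u S w} → HasType n u S w → T (all (λ m → applicable n m u) S)
typed-applicable []           = _
typed-applicable (fixed a r)  = subst T (sym (applicable-cons r a)) (typed-applicable r)
typed-applicable (switch {u = u} a r) = from T-∧ (cornerOK-alternating a u ,
  subst T (sym (trans (applicable-cons (fixed (not a) r) a) (applicable-cons r (not a))))
        (typed-applicable r))
typed-applicable (flip a)     = _

typed-disjoint : ∀ {n u S w} → HasType n u S w → T (pairwiseDisjoint n S)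
typed-disjoint []           = _
typed-disjoint (fixed a r)  = subst T (sym (pairwiseDisjoint-cons r)) (typed-disjoint r)
typed-disjoint (switch a r) = from T-∧ (clear-of-base-corner r ,
  subst T (sym (trans (pairwiseDisjoint-cons (fixed (not a) r)) (pairwiseDisjoint-cons r)))
        (typed-disjoint r))
typed-disjoint (flip a)     = _

-- Stated as a type so that typable can hand its recursive calls to the case analyses below.
Typable : State → Set
Typable u = ∀ {S} → S ∈ subsets (moves (length u)) →
  T (all (λ m → applicable (length u) m u) S) → T (pairwiseDisjoint (length u) S) →
  ∃ (HasType (length u) u S)

-- The moves after the base corner switch must avoid links 0 and 1, which excludes the
-- end flip of QR_2 and the corner switch at link 1.
typable-switch : ∀ a u → Typable u → ∀ {S} → S ∈ subsets (moves (suc (length u))) →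
  T (all (λ m → applicable (suc (suc (length u))) m (a ∷ not a ∷ u)) (map shiftMove S)) →
  T (all (λ m → disjointᵇ (0 ∷ 1 ∷ []) (involved (suc (suc (length u))) m)) (map shiftMove S)) →
  T (pairwiseDisjoint (suc (suc (length u))) (map shiftMove S)) →
  ∃ (HasType (suc (suc (length u))) (a ∷ not a ∷ u) (corner 0 ∷ map shiftMove S))
typable-switch a []      _  (here refl)         _ () _
typable-switch a []      ih (there (here refl)) _ _  _ = C ∷ [] , switch a []
typable-switch a (c ∷ u) ih p app clear dis with movesView (length u) p
typable-switch a (c ∷ u) ih p app () dis | keep q
... | skip {S} q = Product.map (C ∷_) (switch a)
        (ih q (subst T (trans (applicable-shift _ a (not a ∷ c ∷ u) (map shiftMove S))
                              (applicable-shift _ (not a) (c ∷ u) S)) app)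
              (subst T (trans (pairwiseDisjoint-shift _ (map shiftMove S))
                              (pairwiseDisjoint-shift _ S)) dis))

typable-cons : ∀ a b u → Typable u → Typable (b ∷ u) → Typable (a ∷ b ∷ u)
typable-cons a b u ih ih′ p app dis with movesView (length u) p
... | skip {S} q = Product.map (letter a ∷_) (fixed a)
        (ih′ q (subst T (applicable-shift _ a (b ∷ u) S) app) (subst T (pairwiseDisjoint-shift _ S) dis))
... | keep q with to T-∧ app | to T-∧ dis
...   | ok , app′ | clear , dis′ with cornerOK⇒alternating a b u ok
...     | refl = typable-switch a u ih q app′ clear dis′

typable : ∀ u → Typable u
typable []          (here refl)         _ _ = [] , []
typable (a ∷ [])    (here refl)         _ _ = F ∷ [] , flip a
typable (a ∷ [])    (there (here refl)) _ _ = letter a ∷ [] , fixed a []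
typable (a ∷ b ∷ u) = typable-cons a b u (typable u) (typable (b ∷ u))

-- Enumerating the cube types

letters : List Letter
letters = N ∷ E ∷ C ∷ F ∷ []

∈-letters : ∀ l → l ∈ letters
∈-letters N = here refl
∈-letters E = there (here refl)
∈-letters C = there (there (here refl))
∈-letters F = there (there (there (here refl)))

letters-unique : Unique letters
letters-unique = ((λ ()) ∷ (λ ()) ∷ (λ ()) ∷ []) ∷ ((λ ()) ∷ (λ ()) ∷ []) ∷ ((λ ()) ∷ []) ∷ [] ∷ []

-- The types of the d-dimensional cubes of QR_n; an F can only be the last letter.
mutual
  words : ℕ → ℕ → List Word
  words zero    zero    = [] ∷ []
  words zero    (suc d) = []
  words (suc n) d       = concatMap (λ l → map (l ∷_) (suffixes l n d)) letters

  suffixes : Letter → ℕ → ℕ → List Word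
  suffixes N n       d       = words n d
  suffixes E n       d       = words n d
  suffixes C (suc n) (suc d) = words n d
  suffixes C _       _       = []
  suffixes F zero    (suc d) = words zero d
  suffixes F _       _       = []

suffixes-letter : ∀ a n d → suffixes (letter a) n d ≡ words n d
suffixes-letter true  n d = refl
suffixes-letter false n d = refl

mutual
  words-unique : ∀ n d → Unique (words n d)
  words-unique zero    zero    = [] ∷ []
  words-unique zero    (suc d) = []
  words-unique (suc n) d       = unique-prefixed (λ l → suffixes l n d) letters-unique
                                   (λ l → suffixes-unique l n d)

  suffixes-unique : ∀ l n d → Unique (suffixes l n d)
  suffixes-unique N n       d       = words-unique n d
  suffixes-unique E n       d       = words-unique n d
  suffixes-unique C (suc n) (suc d) = words-unique n d
  suffixes-unique C zero    d       = []
  suffixes-unique C (suc n) zero    = []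
  suffixes-unique F zero    (suc d) = words-unique zero d
  suffixes-unique F zero    zero    = []
  suffixes-unique F (suc n) d       = []

∈-words-∷⁺ : ∀ l n d {w} → w ∈ suffixes l n d → l ∷ w ∈ words (suc n) d
∈-words-∷⁺ l n d p = ∈-concatMap⁺ (λ l → map (l ∷_) (suffixes l n d)) (lose (∈-letters l) (∈-map⁺ (l ∷_) p))

∈-words-∷⁻ : ∀ {n d v} → v ∈ words (suc n) d → ∃₂ λ l w → v ≡ l ∷ w × w ∈ suffixes l n d
∈-words-∷⁻ {n} {d} p with find (∈-concatMap⁻ (λ l → map (l ∷_) (suffixes l n d)) {xs = letters} p)
... | l , _ , q with ∈-map⁻ (l ∷_) q
...   | w , q′ , eq = l , w , eq , q′

typed-words : ∀ {n u S w} → HasType n u S w → w ∈ words n (length S)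
typed-words []                           = here refl
typed-words (fixed {n} {S = S} {w} a r)  =
  subst (λ d → letter a ∷ w ∈ words (suc n) d) (sym (length-map shiftMove S))
    (∈-words-∷⁺ (letter a) n (length S) (subst (w ∈_) (sym (suffixes-letter a n (length S))) (typed-words r)))
typed-words (switch {n} {S = S} {w} a r) =
  subst (λ d → C ∷ w ∈ words (suc (suc n)) (suc d))
    (sym (trans (length-map shiftMove (map shiftMove S)) (length-map shiftMove S)))
    (∈-words-∷⁺ C (suc n) (suc (length S)) (typed-words r))
typed-words (flip a)                     = here refl

IsType : ℕ → ℕ → Word → Set
IsType n d w = ∃₂ λ u S → HasType n u S w × length S ≡ d

mutual
  words-typed : ∀ n d {w} → w ∈ words n d → IsType n d w
  words-typed zero    zero (here refl) = [] , [] , [] , refl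
  words-typed (suc n) d    p           with ∈-words-∷⁻ {n} {d} p
  ... | l , w , refl , q = suffixes-typed l n d q

  suffixes-typed : ∀ l n d {w} → w ∈ suffixes l n d → IsType (suc n) d (l ∷ w)
  suffixes-typed N n d {w} q with words-typed n d q
  ... | u , S , r , eq = true ∷ u , map shiftMove S , fixed true r , trans (length-map shiftMove S) eq
  suffixes-typed E n d q with words-typed n d q
  ... | u , S , r , eq = false ∷ u , map shiftMove S , fixed false r , trans (length-map shiftMove S) eq
  suffixes-typed C (suc n) (suc d) q with words-typed n d q
  ... | u , S , r , eq = true ∷ false ∷ u , _ , switch true r ,
          cong suc (trans (length-map shiftMove (map shiftMove S)) (trans (length-map shiftMove S) eq))
  suffixes-typed F zero (suc zero) (here refl) = true ∷ [] , endflip ∷ [] , flip true , refl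

-- Distinct cube types have distinct vertex sets

width : Word → ℕ
width []      = 0
width (C ∷ w) = suc (suc (width w))
width (_ ∷ w) = suc (width w)

typed-width : ∀ {n u S w} → HasType n u S w → width w ≡ n
typed-width []               = refl
typed-width (fixed true r)   = cong suc (typed-width r)
typed-width (fixed false r)  = cong suc (typed-width r)
typed-width (switch a r)     = cong (suc ∘ suc) (typed-width r)
typed-width (flip a)         = refl

◃-length : ∀ a {p : State → Bool} {k} → (∀ v → T (p v) → length v ≡ k) →
  ∀ v → T ((a ◃ p) v) → length v ≡ suc k
◃-length a p-length (b ∷ v) t = cong suc (p-length v (proj₂ (to T-∧ t)))

∨-length : ∀ {p q : State → Bool} {k} → (∀ v → T (p v) → length v ≡ k) →
  (∀ v → T (q v) → length v ≡ k) → ∀ v → T (p v ∨ q v) → length v ≡ k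
∨-length {p} p-length q-length v t = [ p-length v , q-length v ]′ (to (T-∨ {p v}) t)

matches-length : ∀ w v → T (matches w v) → length v ≡ width w
matches-length []      [] _ = refl
matches-length (N ∷ w) = ◃-length true (matches-length w)
matches-length (E ∷ w) = ◃-length false (matches-length w)
matches-length (C ∷ w) = ∨-length (◃-length true  (◃-length false (matches-length w)))
                                  (◃-length false (◃-length true  (matches-length w)))
matches-length (F ∷ w) = ∨-length (◃-length true (matches-length w))
                                  (◃-length false (matches-length w))

matches-outside : ∀ w {v} → length v ≢ width w → matches w v ≡ false
matches-outside w {v} ≢width with matches w v in eq
... | true  = ⊥-elim (≢width (matches-length w v (subst T (sym eq) _)))
... | false = refl

base : Word → State
base []      = []
base (N ∷ w) = true ∷ base w
base (E ∷ w) = false ∷ base w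
base (C ∷ w) = true ∷ false ∷ base w
base (F ∷ w) = true ∷ base w

matches-base : ∀ w → T (matches w (base w))
matches-base []      = _
matches-base (N ∷ w) = matches-base w
matches-base (E ∷ w) = matches-base w
matches-base (C ∷ w) = from T-∨ (inj₁ (matches-base w))
matches-base (F ∷ w) = from T-∨ (inj₁ (matches-base w))

separated : ∀ {p q : State → Bool} v → T (p v) → ¬ T (q v) → ¬ (p ≗ q)
separated v pv ¬qv p≗q = ¬qv (subst T (p≗q v) pv)

∨-false-injective : ∀ {x y} → x ∨ false ≡ y ∨ false → x ≡ y
∨-false-injective {x} {y} eq = trans (sym (∨-identityʳ x)) (trans eq (∨-identityʳ y))

nonempty : ∀ l w → ¬ T (matches (l ∷ w) [])
nonempty N w = λ ()
nonempty E w = λ ()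
nonempty C w = λ ()
nonempty F w = λ ()

N≉E : ∀ w w′ → ¬ (matches (N ∷ w) ≗ matches (E ∷ w′))
N≉E w w′ = separated (true ∷ base w) (matches-base w) (λ ())

N≉C : ∀ w w′ → ¬ (matches (N ∷ w) ≗ matches (C ∷ w′))
N≉C w w′ h = separated (false ∷ true ∷ base w′) (matches-base w′) (λ ()) (sym ∘ h)

N≉F : ∀ w w′ → ¬ (matches (N ∷ w) ≗ matches (F ∷ w′))
N≉F w w′ h = separated (false ∷ base w′) (matches-base w′) (λ ()) (sym ∘ h)

E≉C : ∀ w w′ → ¬ (matches (E ∷ w) ≗ matches (C ∷ w′))
E≉C w w′ h = separated (true ∷ false ∷ base w′) (from T-∨ (inj₁ (matches-base w′))) (λ ()) (sym ∘ h)

E≉F : ∀ w w′ → ¬ (matches (E ∷ w) ≗ matches (F ∷ w′))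
E≉F w w′ h = separated (true ∷ base w′) (from T-∨ (inj₁ (matches-base w′))) (λ ()) (sym ∘ h)

-- C accepts true ∷ false ∷ _ but rejects false ∷ false ∷ _, while F cannot tell them apart.
C≉F : ∀ w w′ → ¬ (matches (C ∷ w) ≗ matches (F ∷ w′))
C≉F w w′ h = separated (false ∷ false ∷ base w) accepted (λ ()) (sym ∘ h)
  where
  accepted : T (matches w′ (false ∷ base w))
  accepted = [ (λ t → t) , (λ ()) ]′ (to (T-∨ {matches w′ (false ∷ base w)}) (subst T (h (true ∷ false ∷ base w))
                                               (from T-∨ (inj₁ (matches-base w)))))

matches-injective : ∀ w w′ → matches w ≗ matches w′ → w ≡ w′
matches-injective []      []       _ = refl
matches-injective []      (l ∷ w′) h = ⊥-elim (separated [] _ (nonempty l w′) h)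
matches-injective (l ∷ w) []       h = ⊥-elim (separated [] _ (nonempty l w) (sym ∘ h))
matches-injective (N ∷ w) (N ∷ w′) h = cong (N ∷_) (matches-injective w w′ (λ v → h (true ∷ v)))
matches-injective (E ∷ w) (E ∷ w′) h = cong (E ∷_) (matches-injective w w′ (λ v → h (false ∷ v)))
matches-injective (C ∷ w) (C ∷ w′) h =
  cong (C ∷_) (matches-injective w w′ (λ v → ∨-false-injective (h (true ∷ false ∷ v))))
matches-injective (F ∷ w) (F ∷ w′) h =
  cong (F ∷_) (matches-injective w w′ (λ v → ∨-false-injective (h (true ∷ v))))
matches-injective (N ∷ w) (E ∷ w′) h = ⊥-elim (N≉E w w′ h)
matches-injective (E ∷ w) (N ∷ w′) h = ⊥-elim (N≉E w′ w (sym ∘ h))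
matches-injective (N ∷ w) (C ∷ w′) h = ⊥-elim (N≉C w w′ h)
matches-injective (C ∷ w) (N ∷ w′) h = ⊥-elim (N≉C w′ w (sym ∘ h))
matches-injective (N ∷ w) (F ∷ w′) h = ⊥-elim (N≉F w w′ h)
matches-injective (F ∷ w) (N ∷ w′) h = ⊥-elim (N≉F w′ w (sym ∘ h))
matches-injective (E ∷ w) (C ∷ w′) h = ⊥-elim (E≉C w w′ h)
matches-injective (C ∷ w) (E ∷ w′) h = ⊥-elim (E≉C w′ w (sym ∘ h))
matches-injective (E ∷ w) (F ∷ w′) h = ⊥-elim (E≉F w w′ h)
matches-injective (F ∷ w) (E ∷ w′) h = ⊥-elim (E≉F w′ w (sym ∘ h))
matches-injective (C ∷ w) (F ∷ w′) h = ⊥-elim (C≉F w w′ h)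
matches-injective (F ∷ w) (C ∷ w′) h = ⊥-elim (C≉F w′ w (sym ∘ h))

∈-allStates⁺ : ∀ {n} v → length v ≡ n → v ∈ allStates n
∈-allStates⁺ []          refl = here refl
∈-allStates⁺ (true ∷ v)  refl = ∈-++⁺ˡ (∈-map⁺ (true ∷_) (∈-allStates⁺ v refl))
∈-allStates⁺ (false ∷ v) refl = ∈-++⁺ʳ _ (∈-map⁺ (false ∷_) (∈-allStates⁺ v refl))

∈-allStates⁻ : ∀ n {v} → v ∈ allStates n → length v ≡ n
∈-allStates⁻ zero    (here refl) = refl
∈-allStates⁻ (suc n) p with ∈-++⁻ (map (true ∷_) (allStates n)) p
... | inj₁ q with ∈-map⁻ (true ∷_) q
...   | _ , q′ , refl = cong suc (∈-allStates⁻ n q′)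
∈-allStates⁻ (suc n) p | inj₂ q with ∈-map⁻ (false ∷_) q
...   | _ , q′ , refl = cong suc (∈-allStates⁻ n q′)

embed : ℕ → Word → List Bool
embed n w = map (matches w) (allStates n)

vertexSet-typed : ∀ {n u S w} → HasType n u S w → vertexSet n (u , S) ≡ embed n w
vertexSet-typed {n} r = map-cong (spans-matches r) (allStates n)

embed-injective : ∀ n {w w′} → width w ≡ n → width w′ ≡ n → embed n w ≡ embed n w′ → w ≡ w′
embed-injective n {w} {w′} w-width w′-width eq = matches-injective w w′ agree
  where
  agree : matches w ≗ matches w′
  agree v with length v ≟ n
  ... | yes v-length = map-≡⇒agree (allStates n) eq (∈-allStates⁺ v v-length)
  ... | no  v-length = trans (matches-outside w  (λ e → v-length (trans e w-width)))
                             (sym (matches-outside w′ (λ e → v-length (trans e w′-width))))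

embeddings-unique : ∀ n d → Unique (map (embed n) (words n d))
embeddings-unique n d = unique-map-injectiveOn injective (words-unique n d)
  where
  words-width : ∀ {w} → w ∈ words n d → width w ≡ n
  words-width p with words-typed n d p
  ... | _ , _ , r , _ = typed-width r
  injective : ∀ {w w′} → w ∈ words n d → w′ ∈ words n d → embed n w ≡ embed n w′ → w ≡ w′
  injective p p′ = embed-injective n (words-width p) (words-width p′)

-- Counting the cubes

eqState⇔≡ : ∀ u v → T (eqState u v) ⇔ u ≡ v
eqState⇔≡ u v = mk⇔ (sound u v) λ { refl → complete u }
  where
  sound : ∀ u v → T (eqState u v) → u ≡ v
  sound []          []          _ = refl
  sound (true ∷ u)  (true ∷ v)  t = cong (true ∷_) (sound u v t)
  sound (false ∷ u) (false ∷ v) t = cong (false ∷_) (sound u v t)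
  complete : ∀ u → T (eqState u u)
  complete []          = _
  complete (true ∷ u)  = complete u
  complete (false ∷ u) = complete u

_≟ˢ_ : (u v : List Bool) → Dec (u ≡ v)
_≟ˢ_ = ≡-dec Bool._≟_

deduplicateᵇ-eqState : ∀ xs → deduplicateᵇ eqState xs ≡ deduplicate _≟ˢ_ xs
deduplicateᵇ-eqState []       = refl
deduplicateᵇ-eqState (x ∷ xs) = cong (x ∷_) (begin
  filter (λ y → ¬? (T? (eqState x y))) (deduplicateᵇ eqState xs)
    ≡⟨ cong (filter _) (deduplicateᵇ-eqState xs) ⟩
  filter (λ y → ¬? (T? (eqState x y))) (deduplicate _≟ˢ_ xs)
    ≡⟨ filter-≐ (λ y → ¬? (T? (eqState x y))) (λ y → ¬? (x ≟ˢ y)) same (deduplicate _≟ˢ_ xs) ⟩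
  filter (λ y → ¬? (x ≟ˢ y)) (deduplicate _≟ˢ_ xs) ∎)
  where
  same : (λ y → ¬ T (eqState x y)) ≐ (λ y → x ≢ y)
  same = (λ {y} ¬t → ¬t ∘ from (eqState⇔≡ x y)) , (λ {y} x≢y → x≢y ∘ to (eqState⇔≡ x y))

candidates : ℕ → List (State × List Move)
candidates n = concatMap (λ u → map (u ,_) (subsets (moves n))) (allStates n)

cube-typed : ∀ n d {u S} → (u , S) ∈ candidates n → T (IsCubeData n d (u , S)) →
  ∃[ w ] HasType n u S w × w ∈ words n d
cube-typed n d {u} {S} c∈ valid
  with ∈-cartesianProduct⁻ (allStates n) (subsets (moves n))
         (subst ((u , S) ∈_) (concatMap-pairs (allStates n) (subsets (moves n))) c∈)
... | u∈ , S∈ with ∈-allStates⁻ n u∈ | to T-∧ valid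
...   | refl | dim , rest with to T-∧ rest
...     | app , dis with typable u S∈ app dis
...       | w , r = w , r , subst (λ k → w ∈ words (length u) k) (≡ᵇ⇒≡ _ _ dim) (typed-words r)

typed-cube : ∀ {n u S w} → HasType n u S w →
  (u , S) ∈ candidates n × T (IsCubeData n (length S) (u , S))
typed-cube {n} {u} {S} r =
  subst ((u , S) ∈_) (sym (concatMap-pairs (allStates n) (subsets (moves n))))
    (∈-cartesianProduct⁺ (∈-allStates⁺ u (typed-length r)) (typed-moves r)) ,
  from T-∧ (≡⇒≡ᵇ (length S) (length S) refl , from T-∧ (typed-applicable r , typed-disjoint r))

vertexSets⇔embeddings : ∀ n d {z} →
  z ∈ map (vertexSet n) (filter (λ c → T? (IsCubeData n d c)) (candidates n)) ⇔
  z ∈ map (embed n) (words n d)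
vertexSets⇔embeddings n d = mk⇔ vertexSet⇒embedding embedding⇒vertexSet
  where
  vertexSet⇒embedding : ∀ {z} → z ∈ map (vertexSet n) (filter (λ c → T? (IsCubeData n d c)) (candidates n)) →
    z ∈ map (embed n) (words n d)
  vertexSet⇒embedding p with ∈-map∘filter⁻ (vertexSet n) (λ c → T? (IsCubeData n d c)) p
  ... | _ , c∈ , refl , valid with cube-typed n d c∈ valid
  ...   | w , r , w∈ = subst (_∈ map (embed n) (words n d)) (sym (vertexSet-typed r)) (∈-map⁺ (embed n) w∈)
  embedding⇒vertexSet : ∀ {z} → z ∈ map (embed n) (words n d) →
    z ∈ map (vertexSet n) (filter (λ c → T? (IsCubeData n d c)) (candidates n))
  embedding⇒vertexSet p with ∈-map⁻ (embed n) p
  ... | w , w∈ , refl with words-typed n d w∈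
  ...   | u , S , r , refl with typed-cube r
  ...     | c∈ , valid = ∈-map∘filter⁺ (vertexSet n) (λ c → T? (IsCubeData n d c))
                           ((u , S) , c∈ , sym (vertexSet-typed r) , valid)

q≡length-words : ∀ n d → q n d ≡ length (words n d)
q≡length-words n d = begin
  q n d                                       ≡⟨ cong length (deduplicateᵇ-eqState (map (vertexSet n) cubes)) ⟩
  length (deduplicate _≟ˢ_ (map (vertexSet n) cubes))
    ≡⟨ length-deduplicate _≟ˢ_ (vertexSets⇔embeddings n d) (embeddings-unique n d) ⟩
  length (map (embed n) (words n d))          ≡⟨ length-map (embed n) (words n d) ⟩
  length (words n d)                          ∎
  where
  cubes = filter (λ c → T? (IsCubeData n d c)) (candidates n)

-- Power series

sumTo-cong : ∀ n {f g : ℕ → ℤ} → (∀ i → i ≤ n → f i ≡ g i) → sumTo n f ≡ sumTo n g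
sumTo-cong zero    f≡g = f≡g 0 z≤n
sumTo-cong (suc n) f≡g = cong₂ _+ℤ_ (sumTo-cong n (λ i i≤n → f≡g i (m≤n⇒m≤1+n i≤n))) (f≡g (suc n) ≤-refl)

sumTo-zero : ∀ n {f : ℕ → ℤ} → (∀ i → i ≤ n → f i ≡ + 0) → sumTo n f ≡ + 0
sumTo-zero n f≡0 = trans (sumTo-cong n f≡0) (vanish n)
  where
  vanish : ∀ n → sumTo n (λ _ → + 0) ≡ + 0
  vanish zero    = refl
  vanish (suc n) = cong (_+ℤ + 0) (vanish n)

sumTo-last : ∀ n {f : ℕ → ℤ} → (∀ i → i < n → f i ≡ + 0) → sumTo n f ≡ f n
sumTo-last zero    _   = refl
sumTo-last (suc n) {f} f≡0 =
  trans (cong (_+ℤ f (suc n)) (sumTo-zero n (λ i i≤n → f≡0 i (s≤s i≤n)))) (+-identityˡ (f (suc n)))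

conv : (ℕ → ℤ) → (ℕ → ℤ) → ℕ → ℤ
conv g h d = sumTo d (λ j → g j *ℤ h (d ∸ j))

conv-zero : ∀ g h → (∀ e → h e ≡ + 0) → ∀ d → conv g h d ≡ + 0
conv-zero g h h≡0 d = sumTo-zero d (λ j _ → trans (cong (g j *ℤ_) (h≡0 (d ∸ j))) (*-zeroʳ (g j)))

conv-const : ∀ g h → (∀ e → h (suc e) ≡ + 0) → ∀ d → conv g h d ≡ g d *ℤ h 0
conv-const g h h≡0 zero    = refl
conv-const g h h≡0 (suc d) = begin
  conv g h (suc d)              ≡⟨ sumTo-last (suc d) vanish ⟩
  g (suc d) *ℤ h (suc d ∸ suc d) ≡⟨ cong (λ e → g (suc d) *ℤ h e) (n∸n≡0 d) ⟩
  g (suc d) *ℤ h 0               ∎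
  where
  vanish : ∀ j → j < suc d → g j *ℤ h (suc d ∸ j) ≡ + 0
  vanish j (s≤s j≤d) = begin
    g j *ℤ h (suc d ∸ j)   ≡⟨ cong (λ e → g j *ℤ h e) (+-∸-assoc 1 j≤d) ⟩
    g j *ℤ h (suc (d ∸ j)) ≡⟨ cong (g j *ℤ_) (h≡0 (d ∸ j)) ⟩
    g j *ℤ + 0             ≡⟨ *-zeroʳ (g j) ⟩
    + 0                    ∎

conv-shift : ∀ g h → h 0 ≡ + 0 → ∀ d → conv g h (suc d) ≡ conv g (h ∘ suc) d
conv-shift g h h0≡0 d = begin
  sumTo d (λ j → g j *ℤ h (suc d ∸ j)) +ℤ g (suc d) *ℤ h (d ∸ d)
    ≡⟨ cong₂ _+ℤ_ (sumTo-cong d (λ j j≤d → cong (λ e → g j *ℤ h e) (+-∸-assoc 1 j≤d)))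
                  (trans (cong (λ e → g (suc d) *ℤ h e) (n∸n≡0 d))
                         (trans (cong (g (suc d) *ℤ_) h0≡0) (*-zeroʳ (g (suc d))))) ⟩
  conv g (h ∘ suc) d +ℤ + 0 ≡⟨ +-identityʳ _ ⟩
  conv g (h ∘ suc) d ∎

x·_ : PS → PS
(x· f) zero    d = + 0
(x· f) (suc n) d = f n d

y·_ : PS → PS
(y· f) n zero    = + 0
(y· f) n (suc d) = f n d

2x+x²y·_ : PS → PS
(2x+x²y· f) n d = + 2 *ℤ (x· f) n d +ℤ (x· x· y· f) n d

conv-denom₀ : ∀ g d → conv g (denom 0) d ≡ g d
conv-denom₀ g d = trans (conv-const g (denom 0) (λ _ → refl) d) (*-identityʳ (g d))

conv-denom₁ : ∀ g d → conv g (denom 1) d ≡ g d *ℤ -[1+ 1 ]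
conv-denom₁ g = conv-const g (denom 1) (λ _ → refl)

conv-denom₂ : ∀ f n d → conv (f n) (denom 2) d ≡ (y· f) n d *ℤ -[1+ 0 ]
conv-denom₂ f n zero    = *-zeroʳ (f n 0)
conv-denom₂ f n (suc d) =
  trans (conv-shift (f n) (denom 2) refl d) (conv-const (f n) (denom 2 ∘ suc) (λ _ → refl) d)

conv-denom₃ : ∀ g k d → conv g (denom (suc (suc (suc k)))) d ≡ + 0
conv-denom₃ g k = conv-zero g (denom (suc (suc (suc k)))) (λ _ → refl)

⋆-denom : ∀ f n d → (f ⋆ denom) n d ≡ f n d - (2x+x²y· f) n d
⋆-denom f zero d = begin
  conv (f 0) (denom 0) d ≡⟨ conv-denom₀ (f 0) d ⟩
  f 0 d                  ≡⟨ +-identityʳ (f 0 d) ⟨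
  f 0 d - + 0            ∎
⋆-denom f (suc zero) d = begin
  conv (f 0) (denom 1) d +ℤ conv (f 1) (denom 0) d
    ≡⟨ cong₂ _+ℤ_ (conv-denom₁ (f 0) d) (conv-denom₀ (f 1) d) ⟩
  f 0 d *ℤ -[1+ 1 ] +ℤ f 1 d       ≡⟨ rearrange (f 0 d) (f 1 d) ⟩
  f 1 d - (+ 2 *ℤ f 0 d +ℤ + 0)   ∎
  where
  rearrange : ∀ a b → a *ℤ -[1+ 1 ] +ℤ b ≡ b - (+ 2 *ℤ a +ℤ + 0)
  rearrange = solve-∀
⋆-denom f (suc (suc m)) d = begin
  sumTo m term +ℤ term (suc m) +ℤ term (suc (suc m))
    ≡⟨ cong₂ _+ℤ_ (cong₂ _+ℤ_ (trans (sumTo-last m vanish) (column m 2 (m+n∸n≡m 2 m)))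
                              (column (suc m) 1 (m+n∸n≡m 1 m)))
                  (column (suc (suc m)) 0 (n∸n≡0 m)) ⟩
  conv (f m) (denom 2) d +ℤ conv (f (suc m)) (denom 1) d +ℤ conv (f (suc (suc m))) (denom 0) d
    ≡⟨ cong₂ _+ℤ_ (cong₂ _+ℤ_ (conv-denom₂ f m d) (conv-denom₁ (f (suc m)) d))
                  (conv-denom₀ (f (suc (suc m))) d) ⟩
  (y· f) m d *ℤ -[1+ 0 ] +ℤ f (suc m) d *ℤ -[1+ 1 ] +ℤ f (suc (suc m)) d
    ≡⟨ rearrange ((y· f) m d) (f (suc m) d) (f (suc (suc m)) d) ⟩
  f (suc (suc m)) d - (+ 2 *ℤ f (suc m) d +ℤ (y· f) m d) ∎
  where
  term : ℕ → ℤ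
  term i = conv (f i) (denom (suc (suc m) ∸ i)) d
  column : ∀ i k → suc (suc m) ∸ i ≡ k → term i ≡ conv (f i) (denom k) d
  column i k eq = cong (λ k → conv (f i) (denom k) d) eq
  vanish : ∀ i → i < m → term i ≡ + 0
  vanish i i<m = trans (column i _ (+-∸-assoc 3 i<m)) (conv-denom₃ (f i) (m ∸ suc i) d)
  rearrange : ∀ a b c → a *ℤ -[1+ 0 ] +ℤ b *ℤ -[1+ 1 ] +ℤ c ≡ c - (+ 2 *ℤ b +ℤ a)
  rearrange = solve-∀

wordCount : PS
wordCount n d = + length (words n d)

⋆-congˡ : ∀ {f g : PS} (h : PS) → (∀ n d → f n d ≡ g n d) → ∀ n d → (f ⋆ h) n d ≡ (g ⋆ h) n d
⋆-congˡ h f≡g n d =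
  sumTo-cong n (λ i _ → sumTo-cong d (λ j _ → cong (_*ℤ h (n ∸ i) (d ∸ j)) (f≡g i j)))

length-words-suc : ∀ n d → length (words (suc n) d) ≡ sum (map (λ l → length (suffixes l n d)) letters)
length-words-suc n d = length-prefixed (λ l → suffixes l n d) letters

y·wordCount : ∀ m d → (y· wordCount) m d ≡ + length (suffixes C (suc m) d)
y·wordCount m zero    = refl
y·wordCount m (suc d) = refl

wordCount-recurrence : ∀ n d → wordCount n d ≡ numer n d +ℤ (2x+x²y· wordCount) n d
wordCount-recurrence zero          zero                = refl
wordCount-recurrence zero          (suc d)             = refl
wordCount-recurrence (suc zero)    zero                = refl
wordCount-recurrence (suc zero)    (suc zero)          = refl
wordCount-recurrence (suc zero)    (suc (suc d))       = refl
wordCount-recurrence (suc (suc m)) d = begin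
  + length (words (suc (suc m)) d)   ≡⟨ cong +_ (length-words-suc (suc m) d) ⟩
  a +ℤ (a +ℤ (b +ℤ + 0))             ≡⟨ rearrange a b ⟩
  + 0 +ℤ (+ 2 *ℤ a +ℤ b)             ≡⟨ cong (λ c → + 0 +ℤ (+ 2 *ℤ a +ℤ c)) (y·wordCount m d) ⟨
  numer (suc (suc m)) d +ℤ (2x+x²y· wordCount) (suc (suc m)) d ∎
  where
  a = wordCount (suc m) d
  b = + length (suffixes C (suc m) d)
  rearrange : ∀ a b → a +ℤ (a +ℤ (b +ℤ + 0)) ≡ + 0 +ℤ (+ 2 *ℤ a +ℤ b)
  rearrange = solve-∀

proposition4p10 : (n d : ℕ) → (Qseries ⋆ denom) n d ≡ numer n d
proposition4p10 n d = begin
  (Qseries ⋆ denom) n d     ≡⟨ ⋆-congˡ denom (λ i j → cong +_ (q≡length-words i j)) n d ⟩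
  (wordCount ⋆ denom) n d   ≡⟨ ⋆-denom wordCount n d ⟩
  wordCount n d - R         ≡⟨ cong (_- R) (wordCount-recurrence n d) ⟩
  numer n d +ℤ R - R        ≡⟨ cancel (numer n d) R ⟩
  numer n d                 ∎
  where
  R = (2x+x²y· wordCount) n d
  cancel : ∀ a r → a +ℤ r - r ≡ a
  cancel = solve-∀
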